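{- For every integer $k\ge 0$, if $G$ is an acyclic digraph with exactly one source, then there exists $X\subseteq V(G)$ with $|X|\le 1+(|G|-1)/(k+1)$ that $k$-covers $V(G)$. Moreover, such an $X$ can be chosen so that either $|G|=1$, or $|X|\le 1+(|G|-2)/(k+1)$, or $X$ is not stable.
   Context: A digraph is a finite directed graph with no loops or parallel edges; acyclic means no directed cycle. A source is a vertex of in-degree zero. A set is stable if no edge has both ends in it. $X$ $k$-covers $Y$ if for every $y\in Y$ there exist $x\in X$ and a directed path of length at most $k$ (length $0$ allowed) from $x$ to $y$. $|G|$ is the number of vertices. -}

module Defs where

open import Data.Nat using (ℕ; zero; suc; _+_; _*_; _∸_; _≤_)
open import Data.Fin using (Fin)
open import Data.Fin.Subset using (Subset; _∈_; ∣_∣)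
open import Data.Bool using (Bool; T)
open import Data.List using (List; []; _∷_)
open import Data.List.Relation.Unary.Unique.Propositional using (Unique)
open import Data.Product using (Σ; ∃; _×_; ∃-syntax)
open import Data.Sum using (_⊎_)
open import Relation.Binary.PropositionalEquality using (_≡_)
open import Relation.Nullary using (¬_)

record Digraph : Set where
  field
    size     : ℕ
    adj      : Fin size → Fin size → Bool
    loopless : ∀ v → ¬ T (adj v v)

open Digraph public

∣_∣ᵥ : Digraph → ℕ
∣ G ∣ᵥ = size G

Edge : (G : Digraph) → Fin (size G) → Fin (size G) → Set
Edge G u v = T (adj G u v)

data Walk (G : Digraph) : ℕ → Fin (size G) → Fin (size G) → Set where
  here : ∀ x → Walk G 0 x x
  step : ∀ {ℓ x y z} → Edge G x y → Walk G ℓ y z → Walk G (suc ℓ) x z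

vertices : ∀ {G ℓ x y} → Walk G ℓ x y → List (Fin (size G))
vertices (here x) = x ∷ []
vertices {x = x} (step e w) = x ∷ vertices w

Path : (G : Digraph) → ℕ → Fin (size G) → Fin (size G) → Set
Path G ℓ x y = Σ (Walk G ℓ x y) (λ w → Unique (vertices w))

Acyclic : Digraph → Set
Acyclic G = ∀ ℓ x y → Path G ℓ x y → ¬ Edge G y x

IsSource : (G : Digraph) → Fin (size G) → Set
IsSource G v = ∀ u → ¬ Edge G u v

ExactlyOneSource : Digraph → Set
ExactlyOneSource G = ∃[ s ] (IsSource G s × (∀ v → IsSource G v → v ≡ s))

Stable : (G : Digraph) → Subset (size G) → Set
Stable G X = ∀ u v → u ∈ X → v ∈ X → ¬ Edge G u v

KCovers : (G : Digraph) → ℕ → Subset (size G) → Subset (size G) → Set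
KCovers G k X Y = ∀ y → y ∈ Y → ∃[ x ] (x ∈ X × ∃[ ℓ ] (ℓ ≤ k × Path G ℓ x y))

{-# OPTIONS --safe #-}
module Submission where

-- Since s is the only source, every other vertex has an in-neighbour; choosing one as its
-- parent yields, by acyclicity, a spanning arborescence rooted at s with a depth function.
-- For each residue c mod k+1 let X_c be s together with the vertices of depth ≡ c. Among
-- the ancestors of a vertex at distance at most k, either one is s or the depths run
-- through k+1 consecutive values, so X_c k-covers G. The classes partition V - s, so some
-- X_c has at most (|G|-1)/(k+1) non-root vertices. If c = 1 attains the minimum, X_1
-- contains s and a child of s, hence is not stable; otherwise the minimum lies strictly
-- below the average, which gives the bound with |G|-2.

open import Defs
open import Data.Bool using (Bool; true; false; _∨_; _∧_; not)
open import Data.Bool.Properties using (T?)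
open import Data.Fin using (Fin; zero; suc; toℕ; punchIn)
open import Data.Fin.Properties
  using (_≟_; any?; toℕ<n; toℕ≤pred[n]; fromℕ<-cong; fromℕ<-toℕ; punchInᵢ≢i; injective⇒≤)
open import Data.Fin.Subset using (Subset; ⊤; ∣_∣; _∈_)
open import Data.List as List using (List; _∷_; length; allFin; take)
open import Data.List.Extrema.Nat using (argmin; f[argmin]≤f[xs])
open import Data.List.Membership.Propositional using () renaming (_∈_ to _∈ₗ_)
open import Data.List.Membership.Propositional.Properties using (∈-allFin; ∈-lookup)
open import Data.List.Relation.Unary.All as All using ([]; _∷_)
open import Data.List.Relation.Unary.All.Properties using (¬Any⇒All¬)
open import Data.List.Relation.Unary.AllPairs using ([]; _∷_)
open import Data.List.Relation.Unary.Any as Any using (here; there)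
open import Data.List.Relation.Unary.Unique.Propositional using (Unique)
open import Data.List.Relation.Unary.Unique.Propositional.Properties using (take⁺)
open import Data.Nat
  using (ℕ; zero; suc; _+_; _*_; _∸_; _≤_; _<_; _≤′_; ≤′-refl; ≤′-step; z≤n; s≤s; NonZero; pred)
open import Data.Nat.DivMod using (_mod_; m%n<n; [m+n]%n≡m%n; m<n⇒m%n≡m)
open import Data.Nat.GeneralisedArithmetic using (fold; iterate-is-fold)
open import Data.Nat.Properties
  using ( +-0-commutativeMonoid; module ≤-Reasoning
        ; ≤-refl; ≤-reflexive; ≤-trans; <-≤-trans; ≤-total; ≤-<-connex; <⇒≤; <-irrefl; n≮n; n<1+n
        ; m<n⇒m<1+n; m≤n⇒m<n∨m≡n; ≤⇒≤′; ≤′⇒≤; <⇒≤pred; suc-injective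
        ; +-suc; +-mono-≤; +-monoʳ-≤; +-mono-<-≤; +-mono-≤-<; *-suc; *-monoʳ-≤
        ; m∸n≤m; m∸n+n≡m; m∸[m∸n]≡n; n∸n≡0; m<n⇒0<n∸m; pred[m∸n]≡m∸[1+n] )
  renaming (_≟_ to _≟ℕ_)
open import Algebra.Properties.CommutativeMonoid.Sum +-0-commutativeMonoid
  using (sum-syntax; ∑-comm; ∑-distrib-+; sum-cong-≗; sum-replicate-zero)
open import Data.Product using (∃-syntax; Σ-syntax; _×_; _,_; proj₁; proj₂)
open import Data.Sum using (_⊎_; inj₁; inj₂)
open import Data.Vec using (tabulate)
open import Data.Vec.Properties using (lookup∘tabulate; lookup⇒[]=)
open import Function using (_∘_)
open import Function.Definitions using (Injective)
open import Level using (0ℓ)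
open import Relation.Binary.PropositionalEquality
open import Relation.Nullary using (¬_; Dec; yes; no; does; contradiction)
open import Relation.Nullary.Decidable using (dec-true; _⊎-dec_)
open import Relation.Unary using (Pred; Decidable)

𝟙 : Bool → ℕ
𝟙 true  = 1
𝟙 false = 0

𝟙-∨ : ∀ a b → 𝟙 (a ∨ b) ≡ 𝟙 a + 𝟙 (not a ∧ b)
𝟙-∨ true  _ = refl
𝟙-∨ false _ = refl

∑-1 : ∀ n → ∑[ i < n ] 1 ≡ n
∑-1 zero    = refl
∑-1 (suc n) = cong suc (∑-1 n)

∑-δ : ∀ {n} (c : Fin n) → ∑[ i < n ] 𝟙 (does (c ≟ i)) ≡ 1
∑-δ {suc n} zero    = cong suc (sum-replicate-zero n)
∑-δ {suc n} (suc c) = ∑-δ c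

∑-¬δ : ∀ {n} (c : Fin n) → ∑[ i < n ] 𝟙 (not (does (c ≟ i))) ≡ n ∸ 1
∑-¬δ {suc n}       zero    = ∑-1 n
∑-¬δ {suc (suc n)} (suc c) = cong suc (∑-¬δ c)

∑-∧-δ : ∀ {n} b (x : Fin n) → ∑[ c < n ] 𝟙 (b ∧ does (x ≟ c)) ≡ 𝟙 b
∑-∧-δ     true  x = ∑-δ x
∑-∧-δ {n} false _ = sum-replicate-zero n

∑-fibres : ∀ {m n} (p : Fin n → Bool) (f : Fin n → Fin m) →
           ∑[ c < m ] ∑[ v < n ] 𝟙 (p v ∧ does (f v ≟ c)) ≡ ∑[ v < n ] 𝟙 (p v)
∑-fibres p f = trans (∑-comm (λ c v → 𝟙 (p v ∧ does (f v ≟ c))))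
                     (sum-cong-≗ (λ v → ∑-∧-δ (p v) (f v)))

∣tabulate∣≡∑ : ∀ {n} (p : Fin n → Bool) → ∣ tabulate p ∣ ≡ ∑[ i < n ] 𝟙 (p i)
∣tabulate∣≡∑ {zero}  p = refl
∣tabulate∣≡∑ {suc n} p with p zero
... | true  = cong suc (∣tabulate∣≡∑ (λ i → p (suc i)))
... | false = ∣tabulate∣≡∑ (λ i → p (suc i))

∈-tabulate : ∀ {n} {P : Pred (Fin n) 0ℓ} (P? : Decidable P) {i} → P i → i ∈ tabulate (does ∘ P?)
∈-tabulate P? {i} p = lookup⇒[]= i _ (trans (lookup∘tabulate (does ∘ P?) i) (dec-true (P? i) p))

*≤∑ : ∀ {n} (f : Fin n → ℕ) {m} → (∀ i → m ≤ f i) → n * m ≤ ∑[ i < n ] f i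
*≤∑ {zero}  f m≤f = z≤n
*≤∑ {suc n} f m≤f = +-mono-≤ (m≤f zero) (*≤∑ (λ i → f (suc i)) (λ i → m≤f (suc i)))

*<∑ : ∀ {n} (f : Fin n → ℕ) {m} → (∀ i → m ≤ f i) → ∀ j → m < f j → n * m < ∑[ i < n ] f i
*<∑ f m≤f zero    m<f = +-mono-<-≤ m<f (*≤∑ (λ i → f (suc i)) (λ i → m≤f (suc i)))
*<∑ f m≤f (suc j) m<f = +-mono-≤-< (m≤f zero) (*<∑ (λ i → f (suc i)) (λ i → m≤f (suc i)) j m<f)

∃-minimiser : ∀ {n} (f : Fin (suc n) → ℕ) → ∃[ r ] (∀ i → f r ≤ f i)
∃-minimiser {n} f = argmin f zero (allFin (suc n)) ,
  λ i → All.lookup (f[argmin]≤f[xs] {f = f} zero (allFin (suc n))) (∈-allFin i)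

∃-below-average : ∀ {n} (f : Fin (suc n) → ℕ) (c : Fin (suc n)) →
                  ∃[ r ] (suc n * f r ≤ ∑[ i < suc n ] f i × (r ≡ c ⊎ suc n * f r < ∑[ i < suc n ] f i))
∃-below-average {n} f c with ∃-minimiser f
... | r , r-min with ≤-<-connex (f c) (f r)
...   | inj₁ fc≤fr = c , ≤-trans (*-monoʳ-≤ (suc n) fc≤fr) (*≤∑ f r-min) , inj₁ refl
...   | inj₂ fr<fc = r , *≤∑ f r-min , inj₂ (*<∑ f r-min c fr<fc)

[m+n]mod-n≡m-mod-n : ∀ m n .{{_ : NonZero n}} → (m + n) mod n ≡ m mod n
[m+n]mod-n≡m-mod-n m n = fromℕ<-cong _ _ ([m+n]%n≡m%n m n) (m%n<n (m + n) n) (m%n<n m n)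

toℕ-mod : ∀ {n} .{{_ : NonZero n}} (c : Fin n) → toℕ c mod n ≡ c
toℕ-mod {n} c = trans (fromℕ<-cong _ _ (m<n⇒m%n≡m (toℕ<n c)) (m%n<n (toℕ c) n) (toℕ<n c))
                      (fromℕ<-toℕ c (toℕ<n c))

∃-residue-in-window : ∀ {k x} → k ≤′ x → (c : Fin (suc k)) → ∃[ j ] (j ≤ k × (x ∸ j) mod suc k ≡ c)
∃-residue-in-window {k} ≤′-refl c =
  k ∸ toℕ c , m∸n≤m k (toℕ c) ,
  trans (cong (_mod suc k) (m∸[m∸n]≡n (toℕ≤pred[n] c))) (toℕ-mod c)
∃-residue-in-window {k} {suc x} (≤′-step k≤x) c with ∃-residue-in-window k≤x c
... | j , j≤k , eq with m≤n⇒m<n∨m≡n j≤k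
...   | inj₁ j<k  = suc j , j<k , eq
...   | inj₂ refl = 0 , z≤n , (begin
  suc x mod suc k            ≡⟨ cong (_mod suc k) (sym (trans (+-suc (x ∸ k) k) (cong suc x∸k+k≡x))) ⟩
  (x ∸ k + suc k) mod suc k  ≡⟨ [m+n]mod-n≡m-mod-n (x ∸ k) (suc k) ⟩
  (x ∸ k) mod suc k          ≡⟨ eq ⟩
  c                          ∎)
  where
  open ≡-Reasoning
  x∸k+k≡x = m∸n+n≡m (≤′⇒≤ k≤x)

∃-≢ : ∀ {n} (i : Fin n) → n ≢ 1 → ∃[ j ] j ≢ i
∃-≢ {suc zero}    i n≢1 = contradiction refl n≢1
∃-≢ {suc (suc n)} i _   = punchIn i zero , punchInᵢ≢i i zero

lookup-injective : ∀ {A : Set} {xs : List A} → Unique xs → Injective _≡_ _≡_ (List.lookup xs)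
lookup-injective (_      ∷ _) {zero}  {zero}  _  = refl
lookup-injective (x∉xs   ∷ _) {zero}  {suc j} eq = contradiction eq (All.lookup x∉xs (∈-lookup j))
lookup-injective (x∉xs   ∷ _) {suc i} {zero}  eq = contradiction (sym eq) (All.lookup x∉xs (∈-lookup i))
lookup-injective (_ ∷ unique) {suc i} {suc j} eq = cong suc (lookup-injective unique eq)

Unique⇒length≤ : ∀ {n} {xs : List (Fin n)} → Unique xs → length xs ≤ n
Unique⇒length≤ unique = injective⇒≤ (lookup-injective unique)

Vertex : Digraph → Set
Vertex G = Fin (size G)

module _ {G : Digraph} where

  trivialPath : ∀ x → Path G 0 x x
  trivialPath x = here x , [] ∷ []

  length-vertices : ∀ {ℓ x y} (w : Walk G ℓ x y) → length (vertices w) ≡ suc ℓ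
  length-vertices (here _)   = refl
  length-vertices (step _ w) = cong suc (length-vertices w)

  path-length< : ∀ {ℓ x y} → Path G ℓ x y → ℓ < size G
  path-length< (w , unique) = subst (_≤ size G) (length-vertices w) (Unique⇒length≤ unique)

  prefix : ∀ {ℓ x y z} (w : Walk G ℓ x z) → y ∈ₗ vertices w →
           ∃[ ℓ′ ] Σ[ w′ ∈ Walk G ℓ′ x y ] vertices w′ ≡ take (suc ℓ′) (vertices w)
  prefix (here x)   (here refl) = 0 , here x , refl
  prefix (step _ _) (here refl) = 0 , here _ , refl
  prefix (step e w) (there y∈w) with prefix w y∈w
  ... | ℓ′ , w′ , eq = suc ℓ′ , step e w′ , cong (_ ∷_) eq

  prefix-path : ∀ {ℓ x y z} (p : Path G ℓ x z) → y ∈ₗ vertices (proj₁ p) → ∃[ ℓ′ ] Path G ℓ′ x y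
  prefix-path (w , unique) y∈w with prefix w y∈w
  ... | ℓ′ , w′ , eq = ℓ′ , w′ , subst Unique (sym eq) (take⁺ (suc ℓ′) unique)

  stepPath : Acyclic G → ∀ {ℓ x y z} → Edge G x y → Path G ℓ y z → Path G (suc ℓ) x z
  stepPath acyclic {x = x} e (w , unique) with Any.any? (x ≟_) (vertices w)
  ... | yes x∈w = contradiction e (acyclic _ _ _ (proj₂ (prefix-path (w , unique) x∈w)))
  ... | no  x∉w = step e w , ¬Any⇒All¬ (vertices w) x∉w ∷ unique

∃-parent : ∀ {G : Digraph} {s} → (∀ v → IsSource G v → v ≡ s) →
           ∃[ parent ] (∀ v → v ≢ s → Edge G (parent v) v)
∃-parent {G} {s} onlySource = parent , parent-edge
  where
  parent : Vertex G → Vertex G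
  parent v with any? (λ u → T? (adj G u v))
  ... | yes (u , _) = u
  ... | no  _       = s   -- only reached for v = s, whose parent is irrelevant

  parent-edge : ∀ v → v ≢ s → Edge G (parent v) v
  parent-edge v v≢s with any? (λ u → T? (adj G u v))
  ... | yes (_ , e) = e
  ... | no  ¬e      = contradiction (onlySource v (λ u e → ¬e (u , e))) v≢s

record SpanningArborescence (G : Digraph) (root : Vertex G) : Set where
  field
    parent       : Vertex G → Vertex G
    depth        : Vertex G → ℕ
    parent-edge  : ∀ v → v ≢ root → Edge G (parent v) v
    depth-root   : depth root ≡ 0
    depth-parent : ∀ v → v ≢ root → depth v ≡ suc (depth (parent v))

module Ancestry {A : Set} (parent : A → A) where

  ancestor : ℕ → A → A
  ancestor j v = fold v parent j

  ancestor-suc : ∀ j v → ancestor (suc j) v ≡ ancestor j (parent v)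
  ancestor-suc j v = trans (iterate-is-fold v parent (suc j)) (sym (iterate-is-fold (parent v) parent j))

module _ {G : Digraph} (acyclic : Acyclic G) {s : Vertex G} (parent : Vertex G → Vertex G)
         (parent-edge : ∀ v → v ≢ s → Edge G (parent v) v) where

  open Ancestry parent

  root-within-or-path : ∀ m v → (∃[ j ] (j < m × ancestor j v ≡ s)) ⊎ Path G m (ancestor m v) v
  root-within-or-path zero    v = inj₂ (trivialPath v)
  root-within-or-path (suc m) v with root-within-or-path m v
  ... | inj₁ (j , j<m , hit) = inj₁ (j , m<n⇒m<1+n j<m , hit)
  ... | inj₂ path with ancestor m v ≟ s
  ...   | yes hit = inj₁ (m , n<1+n m , hit)
  ...   | no  a≢s = inj₂ (stepPath acyclic (parent-edge _ a≢s) path)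

  root-within : ∀ v → ∃[ j ] (j < size G × ancestor j v ≡ s)
  root-within v with root-within-or-path (size G) v
  ... | inj₁ hit  = hit
  ... | inj₂ path = contradiction (path-length< path) (n≮n (size G))

  depthWithin : ℕ → Vertex G → ℕ
  depthWithin zero    v = 0
  depthWithin (suc f) v with v ≟ s
  ... | yes _ = 0
  ... | no  _ = suc (depthWithin f (parent v))

  depthWithin-root : ∀ f → depthWithin f s ≡ 0
  depthWithin-root zero    = refl
  depthWithin-root (suc f) with s ≟ s
  ... | yes _   = refl
  ... | no  s≢s = contradiction refl s≢s

  depthWithin-≢root : ∀ f {v} → v ≢ s → depthWithin (suc f) v ≡ suc (depthWithin f (parent v))
  depthWithin-≢root f {v} v≢s with v ≟ s
  ... | yes v≡s = contradiction v≡s v≢s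
  ... | no  _   = refl

  depthWithin-stable : ∀ m f v → ancestor m v ≡ s → m ≤ f → depthWithin f v ≡ depthWithin m v
  depthWithin-stable zero    f       v refl _         = depthWithin-root f
  depthWithin-stable (suc m) (suc f) v hit  (s≤s m≤f) with v ≟ s
  ... | yes _ = refl
  ... | no  _ = cong suc (depthWithin-stable m f (parent v) (trans (sym (ancestor-suc m v)) hit) m≤f)

  spanningArborescence : SpanningArborescence G s
  spanningArborescence = record
    { parent       = parent
    ; depth        = depth
    ; parent-edge  = parent-edge
    ; depth-root   = depthWithin-root (suc (size G))
    ; depth-parent = depth-parent
    }
    where
    depth : Vertex G → ℕ
    depth = depthWithin (suc (size G))

    depth-parent : ∀ v → v ≢ s → depth v ≡ suc (depth (parent v))
    depth-parent v v≢s with root-within (parent v)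
    ... | j , j<n , hit = begin
      depthWithin (suc (size G)) v              ≡⟨ depthWithin-≢root (size G) v≢s ⟩
      suc (depthWithin (size G) (parent v))     ≡⟨ cong suc (depthWithin-stable j (size G) (parent v) hit (<⇒≤ j<n)) ⟩
      suc (depthWithin j (parent v))            ≡⟨ cong suc (depthWithin-stable j (suc (size G)) (parent v) hit (<⇒≤ (m<n⇒m<1+n j<n))) ⟨
      suc (depth (parent v))                    ∎
      where open ≡-Reasoning

module Layers {G : Digraph} (acyclic : Acyclic G) {s : Vertex G}
              (T : SpanningArborescence G s) (k : ℕ) where

  open SpanningArborescence T
  open Ancestry parent

  depth≡0⇒root : ∀ v → depth v ≡ 0 → v ≡ s
  depth≡0⇒root v d≡0 with v ≟ s
  ... | yes v≡s = v≡s
  ... | no  v≢s with () ← trans (sym d≡0) (depth-parent v v≢s)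

  0<depth⇒≢root : ∀ {v} → 0 < depth v → v ≢ s
  0<depth⇒≢root 0<d refl = <-irrefl (sym depth-root) 0<d

  depth-ancestor : ∀ j v → j ≤ depth v → depth (ancestor j v) ≡ depth v ∸ j
  ancestor-≢root : ∀ j v → j < depth v → ancestor j v ≢ s

  depth-ancestor zero    v _   = refl
  depth-ancestor (suc j) v j<d = begin
    depth (parent (ancestor j v))  ≡⟨ cong pred (depth-parent _ (ancestor-≢root j v j<d)) ⟨
    pred (depth (ancestor j v))    ≡⟨ cong pred (depth-ancestor j v (<⇒≤ j<d)) ⟩
    pred (depth v ∸ j)             ≡⟨ pred[m∸n]≡m∸[1+n] (depth v) j ⟩
    depth v ∸ suc j                ∎
    where open ≡-Reasoning

  ancestor-≢root j v j<d =
    0<depth⇒≢root (subst (0 <_) (sym (depth-ancestor j v (<⇒≤ j<d))) (m<n⇒0<n∸m j<d))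

  ancestor-path : ∀ j v → j ≤ depth v → Path G j (ancestor j v) v
  ancestor-path zero    v _   = trivialPath v
  ancestor-path (suc j) v j<d =
    stepPath acyclic (parent-edge _ (ancestor-≢root j v j<d)) (ancestor-path j v (<⇒≤ j<d))

  ancestor-at-depth : ∀ v → ancestor (depth v) v ≡ s
  ancestor-at-depth v = depth≡0⇒root _ (trans (depth-ancestor (depth v) v ≤-refl) (n∸n≡0 (depth v)))

  class : Vertex G → Fin (suc k)
  class v = depth v mod suc k

  isRoot : Vertex G → Bool
  isRoot v = does (s ≟ v)

  inClass : Fin (suc k) → Vertex G → Bool
  inClass c v = does (class v ≟ c)

  InLayer : Fin (suc k) → Vertex G → Set
  InLayer c v = s ≡ v ⊎ class v ≡ c

  inLayer? : ∀ c → Decidable (InLayer c)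
  inLayer? c v = s ≟ v ⊎-dec class v ≟ c

  layer : Fin (suc k) → Subset (size G)
  layer c = tabulate (does ∘ inLayer? c)

  root∈layer : ∀ c → s ∈ layer c
  root∈layer c = ∈-tabulate (inLayer? c) (inj₁ refl)

  class⇒∈layer : ∀ {v c} → class v ≡ c → v ∈ layer c
  class⇒∈layer {c = c} eq = ∈-tabulate (inLayer? c) (inj₂ eq)

  ∃-ancestor-in-layer : ∀ c v → ∃[ j ] (j ≤ k × j ≤ depth v × ancestor j v ∈ layer c)
  ∃-ancestor-in-layer c v with ≤-total (depth v) k
  ... | inj₁ d≤k = depth v , d≤k , ≤-refl , subst (_∈ layer c) (sym (ancestor-at-depth v)) (root∈layer c)
  ... | inj₂ k≤d with ∃-residue-in-window (≤⇒≤′ k≤d) c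
  ...   | j , j≤k , eq = j , j≤k , j≤d , class⇒∈layer (trans (cong (_mod suc k) (depth-ancestor j v j≤d)) eq)
    where j≤d = ≤-trans j≤k k≤d

  layer-covers : ∀ c → KCovers G k (layer c) ⊤
  layer-covers c v _ with ∃-ancestor-in-layer c v
  ... | j , j≤k , j≤d , a∈layer = ancestor j v , a∈layer , j , j≤k , ancestor-path j v j≤d

  nonRoots : Fin (suc k) → ℕ
  nonRoots c = ∑[ v < size G ] 𝟙 (not (isRoot v) ∧ inClass c v)

  ∣layer∣ : ∀ c → ∣ layer c ∣ ≡ suc (nonRoots c)
  ∣layer∣ c = begin
    ∣ layer c ∣                                                 ≡⟨ ∣tabulate∣≡∑ (does ∘ inLayer? c) ⟩
    ∑[ v < size G ] 𝟙 (isRoot v ∨ inClass c v)                  ≡⟨ sum-cong-≗ (λ v → 𝟙-∨ (isRoot v) (inClass c v)) ⟩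
    ∑[ v < size G ] (𝟙 (isRoot v) + 𝟙 (not (isRoot v) ∧ inClass c v))
                                                                ≡⟨ ∑-distrib-+ (𝟙 ∘ isRoot) (λ v → 𝟙 (not (isRoot v) ∧ inClass c v)) ⟩
    ∑[ v < size G ] 𝟙 (isRoot v) + nonRoots c                   ≡⟨ cong (_+ nonRoots c) (∑-δ s) ⟩
    suc (nonRoots c)                                            ∎
    where open ≡-Reasoning

  ∑-nonRoots : ∑[ c < suc k ] nonRoots c ≡ size G ∸ 1
  ∑-nonRoots = trans (∑-fibres (not ∘ isRoot) class) (∑-¬δ s)

  *∣layer∣≤ : ∀ {c m} → suc k * nonRoots c ≤ m → suc k * ∣ layer c ∣ ≤ suc k + m
  *∣layer∣≤ {c} {m} bound = begin
    suc k * ∣ layer c ∣           ≡⟨ cong (suc k *_) (∣layer∣ c) ⟩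
    suc k * suc (nonRoots c)      ≡⟨ *-suc (suc k) (nonRoots c) ⟩
    suc k + suc k * nonRoots c    ≤⟨ +-monoʳ-≤ (suc k) bound ⟩
    suc k + m                     ∎
    where open ≤-Reasoning

  below-average : ∀ {c} → suc k * nonRoots c ≤ ∑[ c′ < suc k ] nonRoots c′ →
                  suc k * ∣ layer c ∣ ≤ suc k + (size G ∸ 1)
  below-average ≤avg = *∣layer∣≤ (≤-trans ≤avg (≤-reflexive ∑-nonRoots))

  strictly-below-average : ∀ {c} → suc k * nonRoots c < ∑[ c′ < suc k ] nonRoots c′ →
                           suc k * ∣ layer c ∣ ≤ suc k + (size G ∸ 2)
  strictly-below-average <avg = *∣layer∣≤ (≤-trans (<⇒≤pred (<-≤-trans <avg (≤-reflexive ∑-nonRoots)))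
                                                   (≤-reflexive (pred[m∸n]≡m∸[1+n] (size G) 1)))

  ∃-depth-1 : size G ≢ 1 → ∃[ a ] depth a ≡ 1
  ∃-depth-1 n≢1 with ∃-≢ s n≢1
  ... | u , u≢s = ancestor (depth u ∸ 1) u ,
                  trans (depth-ancestor (depth u ∸ 1) u (m∸n≤m (depth u) 1)) (m∸[m∸n]≡n 1≤d)
    where 1≤d = subst (1 ≤_) (sym (depth-parent u u≢s)) (s≤s z≤n)

  depth-1⇒root-edge : ∀ a → depth a ≡ 1 → Edge G s a
  depth-1⇒root-edge a d≡1 = subst (λ p → Edge G p a) parent≡root (parent-edge a a≢s)
    where
    a≢s = 0<depth⇒≢root (≤-reflexive (sym d≡1))
    parent≡root = depth≡0⇒root _ (suc-injective (trans (sym (depth-parent a a≢s)) d≡1))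

  layer-1-unstable : size G ≢ 1 → ¬ Stable G (layer (1 mod suc k))
  layer-1-unstable n≢1 stable with ∃-depth-1 n≢1
  ... | a , d≡1 =
    stable s a (root∈layer _) (class⇒∈layer (cong (_mod suc k) d≡1)) (depth-1⇒root-edge a d≡1)

  trivial-or-smaller-or-unstable :
    ∀ {r} → Dec (size G ≡ 1) → r ≡ 1 mod suc k ⊎ suc k * nonRoots r < ∑[ c < suc k ] nonRoots c →
    size G ≡ 1 ⊎ suc k * ∣ layer r ∣ ≤ suc k + (size G ∸ 2) ⊎ ¬ Stable G (layer r)
  trivial-or-smaller-or-unstable (yes n≡1) _           = inj₁ n≡1
  trivial-or-smaller-or-unstable (no  n≢1) (inj₁ refl) = inj₂ (inj₂ (layer-1-unstable n≢1))
  trivial-or-smaller-or-unstable (no  _)   (inj₂ <avg) = inj₂ (inj₁ (strictly-below-average <avg))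

  small-layer : ∃[ X ] ( KCovers G k X ⊤
                       × suc k * ∣ X ∣ ≤ suc k + (size G ∸ 1)
                       × ( size G ≡ 1
                         ⊎ suc k * ∣ X ∣ ≤ suc k + (size G ∸ 2)
                         ⊎ ¬ Stable G X ) )
  small-layer =
    let r , ≤avg , r≡1⊎<avg = ∃-below-average nonRoots (1 mod suc k)
    in layer r , layer-covers r , below-average ≤avg ,
       trivial-or-smaller-or-unstable (size G ≟ℕ 1) r≡1⊎<avg

mainTheorem8 : (k : ℕ) (G : Digraph) → Acyclic G → ExactlyOneSource G →
    ∃[ X ] ( KCovers G k X ⊤
           × suc k * ∣ X ∣ ≤ suc k + (∣ G ∣ᵥ ∸ 1)
           × ( ∣ G ∣ᵥ ≡ 1
             ⊎ suc k * ∣ X ∣ ≤ suc k + (∣ G ∣ᵥ ∸ 2)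
             ⊎ ¬ Stable G X ) )
mainTheorem8 k G acyclic (s , _ , onlySource) =
  let parent , parent-edge = ∃-parent {G} {s} onlySource
  in Layers.small-layer acyclic (spanningArborescence acyclic parent parent-edge) k
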